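{- Let $d,n\ge 0$ and let $\mathrm{s}=((1-d)/2,(3-d)/2,\dots,(d-1)/2)\in\mathbb{R}^d$. Let $p\in\mathbb{R}^d$ be such that the points $p+\sigma(\mathrm{s})$, $\sigma\in\mathfrak{S}_d$, are $d!$ distinct vertices of $\mathrm{SR}(d,n)$, and let $\mathbf{H}_{p,\mathrm{s}}=\sum_{\sigma\in\mathfrak{S}_d}\varepsilon(\sigma)\mathbf{e}_{p+\sigma(\mathrm{s})}$. Then for every $\alpha\in V(d,n)$ and every $1\le i<j\le d$, the vector $\mathbf{H}_{p,\mathrm{s}}$ is orthogonal (with respect to the standard inner product) to $\mathbf{X}^{(i,j)}_\alpha$.
   Context: $\mathrm{SR}(d,n)$ has vertex set $V(d,n)=\{x\in\mathbb{Z}_{\ge0}^d:\sum_i x_i=n\}$, two vertices adjacent if they differ in exactly two coordinates; $\mathbb{R}^N$, $N=|V(d,n)|$, has standard orthonormal basis $\{\mathbf{e}_x:x\in V(d,n)\}$. $\mathfrak{S}_d$ acts on $\mathbb{R}^d$ by permuting coordinates and $\varepsilon$ is the sign character. For $\alpha\in V(d,n)$ and $i<j$, $\mathbf{X}^{(i,j)}_\alpha=\mathbf{e}_\alpha+\sum_\beta\mathbf{e}_\beta$, the sum over all $\beta\in V(d,n)$, $\beta\ne\alpha$, that agree with $\alpha$ in every coordinate other than the $i$th and $j$th (i.e. the characteristic vector of the lattice line through $\alpha$ in direction $\mathbf{e}_i-\mathbf{e}_j$).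
   Formalization: The point p is taken in ℚ^d rather than ℝ^d. -}

module Defs where

open import Data.Bool using (Bool; true; false; not; _∧_; _∨_; if_then_else_; T)
open import Data.Nat as ℕ using (ℕ; zero; suc; _∸_)
open import Data.Fin as Fin using (Fin; toℕ)
open import Data.Fin.Properties as FinP using ()
open import Data.Integer as ℤ using (ℤ; +_; -[1+_])
open import Data.Rational as ℚ using (ℚ)
open import Data.Rational.Properties as ℚP using ()
open import Data.List as List using (List; []; _∷_; [_]; concatMap; allFin; upTo; length; filter)
open import Data.Bool.ListAction using (any; all)
open import Relation.Binary.PropositionalEquality using (_≡_)
open import Data.Vec as Vec using (Vec; []; _∷_; toList; lookup; tabulate)
open import Data.Vec.Properties as VecP using ()
open import Relation.Nullary.Decidable using (does; ⌊_⌋; T?)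

-- Vertices of SR(d,n): V(d,n) = { x ∈ ℤ≥0^d : Σ x_i = n }.
-- A vertex is a Vec ℕ d whose coordinate sum is n.

IsVertex : (d n : ℕ) → Vec ℕ d → Set
IsVertex d n x = Vec.sum x ≡ n

-- Explicit enumeration (without repetition) of V(d,n).
vertices : (d n : ℕ) → List (Vec ℕ d)
vertices zero zero    = [ [] ]
vertices zero (suc n) = []
vertices (suc d) n    = concatMap (λ k → List.map (k ∷_) (vertices d (n ∸ k))) (upTo (suc n))

-- Vectors of ℝ^N (N = |V(d,n)|) with integer coefficients, given by their
-- coordinates with respect to the basis e_x, x ∈ V(d,n).
-- (All vectors in the statement have integer coordinates.)
RVec : ℕ → Set
RVec d = Vec ℕ d → ℤ

inner : (d n : ℕ) → RVec d → RVec d → ℤ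
inner d n u v = List.foldr ℤ._+_ (+ 0) (List.map (λ x → u x ℤ.* v x) (vertices d n))

-- Points of ℚ^d and the standard basis vector e_y (y ∈ ℚ^d; only used
-- for y ∈ V(d,n), where it is the usual basis vector).

toℚ : ℕ → ℚ
toℚ k = (+ k) ℚ./ 1

embed : ∀ {d} → Vec ℕ d → Vec ℚ d
embed = Vec.map toℚ

e : ∀ {d} → Vec ℚ d → RVec d
e y x = if ⌊ VecP.≡-dec ℚP._≟_ (embed x) y ⌋ then + 1 else + 0

-- The symmetric group 𝔖_d: permutations of Fin d, represented as the
-- vector (σ(0), …, σ(d-1)) of their values.

noDup : ∀ {m} → List (Fin m) → Bool
noDup []       = true
noDup (x ∷ xs) = not (any (λ y → ⌊ x Fin.≟ y ⌋) xs) ∧ noDup xs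

IsPerm : ∀ {d} → Vec (Fin d) d → Set
IsPerm σ = T (noDup (toList σ))

allVecs : ∀ {m} k → List (Vec (Fin m) k)
allVecs zero    = [ [] ]
allVecs {m} (suc k) = concatMap (λ v → List.map (_∷ v) (allFin m)) (allVecs k)

perms : (d : ℕ) → List (Vec (Fin d) d)
perms d = filter (λ σ → T? (noDup (toList σ))) (allVecs d)

inversions : ∀ {m} → List (Fin m) → ℕ
inversions []       = 0
inversions (x ∷ xs) = length (filter (λ y → y Fin.<? x) xs) ℕ.+ inversions xs

sign : ∀ {d} → Vec (Fin d) d → ℤ
sign σ = -[1+ 0 ] ℤ.^ inversions (toList σ)

s : (d : ℕ) → Vec ℚ d
s d = tabulate (λ k → ((+ (2 ℕ.* toℕ k ℕ.+ 1)) ℤ.- (+ d)) ℚ./ 2)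

act : ∀ {d} → Vec (Fin d) d → Vec ℚ d → Vec ℚ d
act σ v = Vec.map (lookup v) σ

pt : ∀ {d} → Vec ℚ d → Vec (Fin d) d → Vec ℚ d
pt {d} p σ = Vec.zipWith ℚ._+_ p (act σ (s d))

H : ∀ {d} → Vec ℚ d → RVec d
H {d} p x = List.foldr ℤ._+_ (+ 0) (List.map (λ σ → sign σ ℤ.* e (pt p σ) x) (perms d))

-- X^{(i,j)}_α: characteristic vector of the set of vertices agreeing with α
-- in every coordinate other than the i-th and j-th (includes α itself).
X : ∀ {d} → Fin d → Fin d → Vec ℕ d → RVec d
X {d} i j α x =
  if all (λ k → ⌊ k Fin.≟ i ⌋ ∨ ⌊ k Fin.≟ j ⌋ ∨ ⌊ lookup x k ℕ.≟ lookup α k ⌋) (allFin d)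
  then + 1 else + 0

module Submission where

-- By linearity ⟨H, X⟩ = Σ_σ ε(σ) X(w_σ), where w_σ is the vertex p + σ(s). Exchanging the
-- values of σ at positions i and j (that is, composing σ with the transposition (i j)) is an
-- involution of 𝔖_d that reverses ε and moves w_σ only in the coordinates i and j, which
-- X^{(i,j)}_α ignores; so the terms cancel in pairs.

open import Defs
import Algebra.Properties.CommutativeSemigroup as CSemigroup
open import Data.Bool.Base using (Bool; true; false; T; not; _∨_; if_then_else_)
open import Data.Bool.Properties using (T-∧)
open import Data.Bool.ListAction using (any; and)
open import Data.Empty using (⊥-elim)
open import Data.Fin.Base as Fin using (Fin; _<_)
import Data.Fin.Properties as FinP
open import Data.Integer.Base as ℤ using (ℤ; +_; -_; -[1+_]; _+_; _*_)
import Data.Integer.GCD as ℤGCD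
import Data.Integer.Properties as ℤP
open import Data.List.Base as List using (List; []; _∷_; _++_; [_]; concatMap; filter; length; upTo; allFin)
import Data.List.Properties as ListP
open import Data.List.Membership.Propositional using (_∈_; _∉_)
open import Data.List.Membership.Propositional.Properties using (∈-upTo⁺; ∈-allFin)
open import Data.List.Relation.Binary.Permutation.Propositional as Perm using (_↭_; ↭⇒↭ₛ)
import Data.List.Relation.Binary.Permutation.Propositional.Properties as PermP
import Data.List.Relation.Binary.Permutation.Setoid.Properties as PermₛP
open import Data.List.Relation.Unary.All as All using (All; []; _∷_)
import Data.List.Relation.Unary.All.Properties as AllP
open import Data.List.Relation.Unary.AllPairs using ([]; _∷_)
open import Data.List.Relation.Unary.Any using (here; there)
open import Data.List.Relation.Unary.Unique.Propositional using (Unique)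
open import Data.List.Relation.Unary.Unique.Propositional.Properties using (upTo⁺; allFin⁺; Unique[x∷xs]⇒x∉xs)
open import Data.Nat.Base as ℕ using (ℕ; zero; suc; _∸_)
import Data.Nat.Properties as ℕP
open import Data.Product.Base using (Σ; _×_; _,_; proj₁; proj₂; ∃; ∃₂)
open import Data.Rational.Base as ℚ using (ℚ)
import Data.Rational.Properties as ℚP
open import Data.Vec.Base as Vec using (Vec; []; _∷_; lookup; toList; _[_]≔_)
import Data.Vec.Properties as VecP
open import Function.Base using (_∘_)
open import Function.Bundles using (_⇔_; mk⇔; Equivalence)
open import Relation.Binary.Definitions using (DecidableEquality; tri<; tri≈; tri>)
open import Relation.Binary.PropositionalEquality hiding ([_])
open import Relation.Nullary using (yes; no; does)
open import Relation.Nullary.Decidable using (⌊_⌋; T?)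
open import Relation.Unary using (Pred; Decidable)

∑ : {A : Set} → List A → (A → ℤ) → ℤ
∑ xs f = List.foldr _+_ (+ 0) (List.map f xs)

module _ {A : Set} where

  ∑-cong : ∀ xs {f g : A → ℤ} → (∀ x → f x ≡ g x) → ∑ xs f ≡ ∑ xs g
  ∑-cong []       f≗g = refl
  ∑-cong (x ∷ xs) f≗g = cong₂ ℤ._+_ (f≗g x) (∑-cong xs f≗g)

  ∑-zero : ∀ (xs : List A) → ∑ xs (λ _ → + 0) ≡ + 0
  ∑-zero []       = refl
  ∑-zero (x ∷ xs) = trans (ℤP.+-identityˡ _) (∑-zero xs)

  ∑-+ : ∀ xs (f g : A → ℤ) → ∑ xs (λ x → f x + g x) ≡ ∑ xs f + ∑ xs g
  ∑-+ []       f g = refl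
  ∑-+ (x ∷ xs) f g = trans (cong (_+_ (f x + g x)) (∑-+ xs f g))
                           (CSemigroup.interchange ℤP.+-commutativeSemigroup (f x) (g x) _ _)

  ∑-neg : ∀ xs (f : A → ℤ) → ∑ xs (λ x → - f x) ≡ - ∑ xs f
  ∑-neg []       f = refl
  ∑-neg (x ∷ xs) f = trans (cong (_+_ (- f x)) (∑-neg xs f)) (sym (ℤP.neg-distrib-+ (f x) _))

  ∑-*ˡ : ∀ xs c (f : A → ℤ) → ∑ xs (λ x → c * f x) ≡ c * ∑ xs f
  ∑-*ˡ []       c f = sym (ℤP.*-zeroʳ c)
  ∑-*ˡ (x ∷ xs) c f = trans (cong (_+_ (c * f x)) (∑-*ˡ xs c f)) (sym (ℤP.*-distribˡ-+ c (f x) _))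

  ∑-*ʳ : ∀ xs (f : A → ℤ) c → ∑ xs (λ x → f x * c) ≡ ∑ xs f * c
  ∑-*ʳ []       f c = sym (ℤP.*-zeroˡ c)
  ∑-*ʳ (x ∷ xs) f c = trans (cong (_+_ (f x * c)) (∑-*ʳ xs f c)) (sym (ℤP.*-distribʳ-+ c (f x) _))

  ∑-++ : ∀ xs ys (f : A → ℤ) → ∑ (xs ++ ys) f ≡ ∑ xs f + ∑ ys f
  ∑-++ []       ys f = sym (ℤP.+-identityˡ _)
  ∑-++ (x ∷ xs) ys f = trans (cong (_+_ (f x)) (∑-++ xs ys f)) (sym (ℤP.+-assoc (f x) _ _))

  ∑-filter : ∀ {ℓ} {P : Pred A ℓ} (P? : Decidable P) xs (f : A → ℤ) →
             ∑ (filter P? xs) f ≡ ∑ xs (λ x → if does (P? x) then f x else + 0)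
  ∑-filter P? []       f = refl
  ∑-filter P? (x ∷ xs) f with does (P? x)
  ... | true  = cong (_+_ (f x)) (∑-filter P? xs f)
  ... | false = trans (∑-filter P? xs f) (sym (ℤP.+-identityˡ _))

module _ {A B : Set} where

  ∑-map : ∀ (h : A → B) xs (f : B → ℤ) → ∑ (List.map h xs) f ≡ ∑ xs (f ∘ h)
  ∑-map h []       f = refl
  ∑-map h (x ∷ xs) f = cong (_+_ (f (h x))) (∑-map h xs f)

  ∑-concatMap : ∀ (g : A → List B) xs (f : B → ℤ) → ∑ (concatMap g xs) f ≡ ∑ xs (λ x → ∑ (g x) f)
  ∑-concatMap g []       f = refl
  ∑-concatMap g (x ∷ xs) f =
    trans (∑-++ (g x) (concatMap g xs) f) (cong (_+_ (∑ (g x) f)) (∑-concatMap g xs f))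

  ∑-comm : ∀ xs ys (f : A → B → ℤ) → ∑ xs (λ x → ∑ ys (f x)) ≡ ∑ ys (λ y → ∑ xs (λ x → f x y))
  ∑-comm []       ys f = sym (∑-zero ys)
  ∑-comm (x ∷ xs) ys f = trans (cong (_+_ (∑ ys (f x))) (∑-comm xs ys f)) (sym (∑-+ ys (f x) _))

x≡-x⇒x≡0 : ∀ {x : ℤ} → x ≡ - x → x ≡ + 0
x≡-x⇒x≡0 {+ zero} _ = refl

module Multiplicity {A : Set} (_≟_ : DecidableEquality A) where

  δ : A → A → ℤ
  δ a x = if ⌊ x ≟ a ⌋ then + 1 else + 0

  multiplicity : A → List A → ℤ
  multiplicity a xs = ∑ xs (δ a)

  IsEnumeration : List A → Set
  IsEnumeration xs = ∀ a → multiplicity a xs ≡ + 1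

  ∑-δ : ∀ a xs (g : A → ℤ) → ∑ xs (λ x → δ a x * g x) ≡ multiplicity a xs * g a
  ∑-δ a []       g = refl
  ∑-δ a (x ∷ xs) g with x ≟ a
  ... | yes refl = trans (cong (_+_ (+ 1 * g a)) (∑-δ a xs g)) (sym (ℤP.*-distribʳ-+ (g a) (+ 1) (multiplicity a xs)))
  ... | no _     = trans (ℤP.+-identityˡ _) (trans (∑-δ a xs g) (cong (_* g a) (sym (ℤP.+-identityˡ (multiplicity a xs)))))

  multiplicity-∉ : ∀ a xs → a ∉ xs → multiplicity a xs ≡ + 0
  multiplicity-∉ a []       _   = refl
  multiplicity-∉ a (x ∷ xs) a∉ with x ≟ a
  ... | yes refl = ⊥-elim (a∉ (here refl))
  ... | no _     = trans (ℤP.+-identityˡ _) (multiplicity-∉ a xs (a∉ ∘ there))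

  multiplicity-unique : ∀ {a xs} → Unique xs → a ∈ xs → multiplicity a xs ≡ + 1
  multiplicity-unique {a} {_ ∷ xs} u (here refl) with a ≟ a
  ... | yes _   = cong (_+_ (+ 1)) (multiplicity-∉ a xs (Unique[x∷xs]⇒x∉xs u))
  ... | no a≢a  = ⊥-elim (a≢a refl)
  multiplicity-unique {a} {x ∷ _} u@(_ ∷ u′) (there a∈) with x ≟ a
  ... | yes refl = ⊥-elim (Unique[x∷xs]⇒x∉xs u a∈)
  ... | no _     = trans (ℤP.+-identityˡ _) (multiplicity-unique u′ a∈)

  ∑-∘-involution : ∀ xs → IsEnumeration xs → (f : A → A) → (∀ a → f (f a) ≡ a) →
                   (g : A → ℤ) → ∑ xs (g ∘ f) ≡ ∑ xs g
  ∑-∘-involution xs once f f∘f≡id g = begin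
      ∑ xs (g ∘ f)                                ≡⟨ ∑-cong xs (λ x → sym (pick (f x) g)) ⟩
      ∑ xs (λ x → ∑ xs (λ y → δ (f x) y * g y))   ≡⟨ ∑-comm xs xs _ ⟩
      ∑ xs (λ y → ∑ xs (λ x → δ (f x) y * g y))   ≡⟨ ∑-cong xs (λ y → ∑-cong xs (λ x → cong (_* g y) (δ-swap x y))) ⟩
      ∑ xs (λ y → ∑ xs (λ x → δ (f y) x * g y))   ≡⟨ ∑-cong xs (λ y → pick (f y) (λ _ → g y)) ⟩
      ∑ xs g                                      ∎
    where
    open ≡-Reasoning
    pick : ∀ a (h : A → ℤ) → ∑ xs (λ x → δ a x * h x) ≡ h a
    pick a h = trans (∑-δ a xs h) (trans (cong (_* h a) (once a)) (ℤP.*-identityˡ (h a)))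
    δ-swap : ∀ x y → δ (f x) y ≡ δ (f y) x
    δ-swap x y with y ≟ f x | x ≟ f y
    ... | yes _    | yes _    = refl
    ... | no _     | no _     = refl
    ... | yes y≡fx | no x≢fy  = ⊥-elim (x≢fy (trans (sym (f∘f≡id x)) (cong f (sym y≡fx))))
    ... | no y≢fx  | yes x≡fy = ⊥-elim (y≢fx (trans (sym (f∘f≡id y)) (cong f (sym x≡fy))))

  ∑-sign-reversing-involution : ∀ xs → IsEnumeration xs → (f : A → A) → (∀ a → f (f a) ≡ a) →
                                (g : A → ℤ) → (∀ a → g (f a) ≡ - g a) → ∑ xs g ≡ + 0
  ∑-sign-reversing-involution xs once f f∘f≡id g g∘f≡-g = x≡-x⇒x≡0 (begin
      ∑ xs g               ≡⟨ sym (∑-∘-involution xs once f f∘f≡id g) ⟩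
      ∑ xs (g ∘ f)         ≡⟨ ∑-cong xs g∘f≡-g ⟩
      ∑ xs (λ a → - g a)   ≡⟨ ∑-neg xs g ⟩
      - ∑ xs g             ∎)
    where open ≡-Reasoning

module _ {X Y A : Set} (_≟X_ : DecidableEquality X) (_≟Y_ : DecidableEquality Y) (_≟A_ : DecidableEquality A)
         (h : X → Y → A) (h-injective : ∀ {x x′ y y′} → h x y ≡ h x′ y′ → x ≡ x′ × y ≡ y′) where

  private
    module MX = Multiplicity _≟X_
    module MY = Multiplicity _≟Y_
    module MA = Multiplicity _≟A_

    δ-h : ∀ x y x′ y′ → MA.δ (h x y) (h x′ y′) ≡ MX.δ x x′ * MY.δ y y′
    δ-h x y x′ y′ with h x′ y′ ≟A h x y | x′ ≟X x | y′ ≟Y y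
    ... | yes _  | yes _    | yes _    = refl
    ... | yes eq | no x′≢x  | _        = ⊥-elim (x′≢x (proj₁ (h-injective eq)))
    ... | yes eq | yes _    | no y′≢y  = ⊥-elim (y′≢y (proj₂ (h-injective eq)))
    ... | no neq | yes refl | yes refl = ⊥-elim (neq refl)
    ... | no _   | yes _    | no _     = refl
    ... | no _   | no _     | yes _    = refl
    ... | no _   | no _     | no _     = refl

  multiplicity-concatMap : ∀ x y (ys : X → List Y) xs →
    MA.multiplicity (h x y) (concatMap (λ x′ → List.map (h x′) (ys x′)) xs)
      ≡ MX.multiplicity x xs * MY.multiplicity y (ys x)
  multiplicity-concatMap x y ys xs = begin
      ∑ (concatMap (λ x′ → List.map (h x′) (ys x′)) xs) (MA.δ (h x y))
        ≡⟨ ∑-concatMap (λ x′ → List.map (h x′) (ys x′)) xs _ ⟩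
      ∑ xs (λ x′ → ∑ (List.map (h x′) (ys x′)) (MA.δ (h x y)))
        ≡⟨ ∑-cong xs (λ x′ → ∑-map (h x′) (ys x′) _) ⟩
      ∑ xs (λ x′ → ∑ (ys x′) (λ y′ → MA.δ (h x y) (h x′ y′)))
        ≡⟨ ∑-cong xs (λ x′ → trans (∑-cong (ys x′) (δ-h x y x′)) (∑-*ˡ (ys x′) (MX.δ x x′) (MY.δ y))) ⟩
      ∑ xs (λ x′ → MX.δ x x′ * MY.multiplicity y (ys x′))
        ≡⟨ MX.∑-δ x xs (λ x′ → MY.multiplicity y (ys x′)) ⟩
      MX.multiplicity x xs * MY.multiplicity y (ys x) ∎
    where open ≡-Reasoning

vertices-multiplicity : ∀ d n {w : Vec ℕ d} → IsVertex d n w →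
                        Multiplicity.multiplicity (VecP.≡-dec ℕP._≟_) w (vertices d n) ≡ + 1
vertices-multiplicity zero    .0 {[]}     refl = refl
vertices-multiplicity (suc d) .(w₀ ℕ.+ Vec.sum w) {w₀ ∷ w} refl =
  trans (multiplicity-concatMap ℕP._≟_ (VecP.≡-dec ℕP._≟_) (VecP.≡-dec ℕP._≟_) _∷_ VecP.∷-injective
                                w₀ w (λ k → vertices d (n ∸ k)) (upTo (suc n)))
        (cong₂ _*_ (Multiplicity.multiplicity-unique ℕP._≟_ (upTo⁺ (suc n)) (∈-upTo⁺ (ℕ.s≤s (ℕP.m≤m+n w₀ (Vec.sum w)))))
                   (vertices-multiplicity d (n ∸ w₀) (sym (ℕP.m+n∸m≡n w₀ (Vec.sum w)))))
  where
  n : ℕ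
  n = w₀ ℕ.+ Vec.sum w

allVecs-enumeration : ∀ {m} k → Multiplicity.IsEnumeration (VecP.≡-dec (FinP._≟_ {m})) (allVecs k)
allVecs-enumeration zero    []      = refl
allVecs-enumeration {m} (suc k) (b ∷ v) =
  trans (multiplicity-concatMap (VecP.≡-dec FinP._≟_) FinP._≟_ (VecP.≡-dec FinP._≟_) (λ v b → b ∷ v)
                                (λ eq → VecP.∷-injectiveʳ eq , VecP.∷-injectiveˡ eq)
                                v b (λ _ → allFin m) (allVecs k))
        (cong₂ _*_ (allVecs-enumeration k v) (Multiplicity.multiplicity-unique FinP._≟_ (allFin⁺ m) (∈-allFin b)))

module _ {A : Set} where

  swapAt : ∀ {n} → Vec A n → Fin n → Fin n → Vec A n
  swapAt v i j = (v [ i ]≔ lookup v j) [ j ]≔ lookup v i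

  lookup-swapAt-other : ∀ {n} (v : Vec A n) {i j k} → k ≢ i → k ≢ j → lookup (swapAt v i j) k ≡ lookup v k
  lookup-swapAt-other v {i} {j} k≢i k≢j =
    trans (VecP.lookup∘update′ k≢j (v [ i ]≔ lookup v j) (lookup v i)) (VecP.lookup∘update′ k≢i v (lookup v j))

  swapAt-involutive : ∀ {n} {i j : Fin n} → i ≢ j → ∀ v → swapAt (swapAt v i j) i j ≡ v
  swapAt-involutive {i = i} {j} i≢j v = begin
      (τ [ i ]≔ lookup τ j) [ j ]≔ lookup τ i ≡⟨ cong₂ (λ x y → (τ [ i ]≔ x) [ j ]≔ y) τⱼ τᵢ ⟩
      (τ [ i ]≔ a) [ j ]≔ b                   ≡⟨ cong (_[ j ]≔ b) (VecP.[]≔-commutes u j i (i≢j ∘ sym)) ⟩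
      ((u [ i ]≔ a) [ j ]≔ a) [ j ]≔ b        ≡⟨ VecP.[]≔-idempotent (u [ i ]≔ a) j ⟩
      (u [ i ]≔ a) [ j ]≔ b                   ≡⟨ cong (_[ j ]≔ b) (VecP.[]≔-idempotent v i) ⟩
      (v [ i ]≔ a) [ j ]≔ b                   ≡⟨ cong (_[ j ]≔ b) (VecP.[]≔-lookup v i) ⟩
      v [ j ]≔ b                              ≡⟨ VecP.[]≔-lookup v j ⟩
      v                                       ∎
    where
    open ≡-Reasoning
    a b : A
    a = lookup v i
    b = lookup v j
    u τ : Vec A _
    u = v [ i ]≔ b
    τ = u [ j ]≔ a
    τⱼ : lookup τ j ≡ a
    τⱼ = VecP.lookup∘update j u a
    τᵢ : lookup τ i ≡ b
    τᵢ = trans (VecP.lookup∘update′ i≢j u a) (VecP.lookup∘update i v b)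

  toList-[]≔ : ∀ {n} (v : Vec A n) k x →
               ∃₂ λ B C → toList v ≡ B ++ lookup v k ∷ C × toList (v [ k ]≔ x) ≡ B ++ x ∷ C
  toList-[]≔ (y ∷ v) Fin.zero    x = [] , toList v , refl , refl
  toList-[]≔ (y ∷ v) (Fin.suc k) x with toList-[]≔ v k x
  ... | B , C , v≡ , v′≡ = y ∷ B , C , cong (y ∷_) v≡ , cong (y ∷_) v′≡

  toList-swapAt : ∀ {n} (v : Vec A n) {i j} → i < j → ∃₂ λ P B → ∃ λ C →
                  toList v ≡ P ++ lookup v i ∷ B ++ lookup v j ∷ C ×
                  toList (swapAt v i j) ≡ P ++ lookup v j ∷ B ++ lookup v i ∷ C
  toList-swapAt (x ∷ v) {Fin.zero} {Fin.suc j} _ with toList-[]≔ v j x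
  ... | B , C , v≡ , v′≡ = [] , B , C , cong (x ∷_) v≡ , cong (lookup v j ∷_) v′≡
  toList-swapAt (x ∷ v) {Fin.suc i} {Fin.suc j} (ℕ.s≤s i<j) with toList-swapAt v i<j
  ... | P , B , C , v≡ , v′≡ = x ∷ P , B , C , cong (x ∷_) v≡ , cong (x ∷_) v′≡

module _ {m : ℕ} where

  listSign : List (Fin m) → ℤ
  listSign xs = -[1+ 0 ] ℤ.^ inversions xs

  private
    smaller : Fin m → List (Fin m) → ℕ
    smaller x xs = length (filter (FinP._<? x) xs)

    smaller-swap : ∀ a A (x y : Fin m) C → smaller a (A ++ y ∷ x ∷ C) ≡ smaller a (A ++ x ∷ y ∷ C)
    smaller-swap a A x y C = PermP.↭-length (PermP.filter-↭ (FinP._<? a) (PermP.++⁺ˡ A (Perm.↭-swap y x Perm.↭-refl)))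

  inversions-swap-adjacent : ∀ A {x y : Fin m} C → x < y →
                             inversions (A ++ y ∷ x ∷ C) ≡ suc (inversions (A ++ x ∷ y ∷ C))
  inversions-swap-adjacent [] {x} {y} C x<y = begin
      length (filter (FinP._<? y) (x ∷ C)) ℕ.+ (smaller x C ℕ.+ inversions C)
        ≡⟨ cong (λ l → length l ℕ.+ _) (ListP.filter-accept (FinP._<? y) x<y) ⟩
      suc (smaller y C ℕ.+ (smaller x C ℕ.+ inversions C))
        ≡⟨ cong suc (CSemigroup.x∙yz≈y∙xz ℕP.+-commutativeSemigroup (smaller y C) (smaller x C) (inversions C)) ⟩
      suc (smaller x C ℕ.+ (smaller y C ℕ.+ inversions C))
        ≡⟨ cong (λ l → suc (length l ℕ.+ _)) (sym (ListP.filter-reject (FinP._<? x) (FinP.<-asym x<y))) ⟩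
      suc (length (filter (FinP._<? x) (y ∷ C)) ℕ.+ (smaller y C ℕ.+ inversions C)) ∎
    where open ≡-Reasoning
  inversions-swap-adjacent (a ∷ A) {x} {y} C x<y =
    trans (cong₂ ℕ._+_ (smaller-swap a A x y C) (inversions-swap-adjacent A C x<y))
          (ℕP.+-suc (smaller a (A ++ x ∷ y ∷ C)) _)

  private
    listSign-swap-< : ∀ A {x y : Fin m} C → x < y → listSign (A ++ y ∷ x ∷ C) ≡ - listSign (A ++ x ∷ y ∷ C)
    listSign-swap-< A C x<y = trans (cong (-[1+ 0 ] ℤ.^_) (inversions-swap-adjacent A C x<y)) (ℤP.-1*i≡-i _)

  listSign-swap-adjacent : ∀ A {x y : Fin m} C → x ≢ y → listSign (A ++ y ∷ x ∷ C) ≡ - listSign (A ++ x ∷ y ∷ C)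
  listSign-swap-adjacent A {x} {y} C x≢y with FinP.<-cmp x y
  ... | tri< x<y _ _ = listSign-swap-< A C x<y
  ... | tri≈ _ x≡y _ = ⊥-elim (x≢y x≡y)
  ... | tri> _ _ y<x = sym (trans (cong -_ (listSign-swap-< A C y<x)) (ℤP.neg-involutive _))

  listSign-transpose : ∀ A {a b : Fin m} B C → Unique (a ∷ B ++ b ∷ C) →
                       listSign (A ++ b ∷ B ++ a ∷ C) ≡ - listSign (A ++ a ∷ B ++ b ∷ C)
  listSign-transpose A []      C ((a≢b ∷ _) ∷ _) = listSign-swap-adjacent A C a≢b
  listSign-transpose A {a} {b} (c ∷ B) C ((a≢c ∷ a≢B⋯) ∷ c≢B⋯ ∷ u) = begin
      listSign (A ++ b ∷ c ∷ B ++ a ∷ C)            ≡⟨ listSign-swap-adjacent A (B ++ a ∷ C) c≢b ⟩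
      - listSign (A ++ c ∷ b ∷ B ++ a ∷ C)          ≡⟨ cong (-_ ∘ listSign) (sym (ListP.++-assoc A [ c ] _)) ⟩
      - listSign ((A ++ [ c ]) ++ b ∷ B ++ a ∷ C)   ≡⟨ cong -_ (listSign-transpose (A ++ [ c ]) B C (a≢B⋯ ∷ u)) ⟩
      - - listSign ((A ++ [ c ]) ++ a ∷ B ++ b ∷ C) ≡⟨ ℤP.neg-involutive _ ⟩
      listSign ((A ++ [ c ]) ++ a ∷ B ++ b ∷ C)     ≡⟨ cong listSign (ListP.++-assoc A [ c ] _) ⟩
      listSign (A ++ c ∷ a ∷ B ++ b ∷ C)            ≡⟨ listSign-swap-adjacent A (B ++ b ∷ C) a≢c ⟩
      - listSign (A ++ a ∷ c ∷ B ++ b ∷ C)          ∎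
    where
    open ≡-Reasoning
    c≢b : c ≢ b
    c≢b = All.head (AllP.++⁻ʳ B c≢B⋯)

Unique-++⁻ʳ : ∀ {A : Set} (P : List A) {xs} → Unique (P ++ xs) → Unique xs
Unique-++⁻ʳ []      u       = u
Unique-++⁻ʳ (_ ∷ P) (_ ∷ u) = Unique-++⁻ʳ P u

↭-transpose : ∀ {A : Set} P (a : A) B b C → P ++ a ∷ B ++ b ∷ C ↭ P ++ b ∷ B ++ a ∷ C
↭-transpose P a B b C = PermP.++⁺ˡ P (Perm.↭-trans (Perm.↭-prep a (PermP.shift b B C))
                                     (Perm.↭-trans (Perm.↭-swap a b Perm.↭-refl)
                                                   (Perm.↭-prep b (Perm.↭-sym (PermP.shift a B C)))))

T-injective : ∀ {a b : Bool} → (T a → T b) → (T b → T a) → a ≡ b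
T-injective {false} {false} _   _   = refl
T-injective {false} {true}  _   b⇒a = ⊥-elim (b⇒a _)
T-injective {true}  {false} a⇒b _   = ⊥-elim (a⇒b _)
T-injective {true}  {true}  _   _   = refl

module _ {m : ℕ} where

  private
    T-not-any⇔All≢ : ∀ (x : Fin m) xs → T (not (any (λ y → ⌊ x FinP.≟ y ⌋) xs)) ⇔ All (x ≢_) xs
    T-not-any⇔All≢ x []       = mk⇔ (λ _ → []) (λ _ → _)
    T-not-any⇔All≢ x (y ∷ ys) with x FinP.≟ y
    ... | yes x≡y = mk⇔ (λ ()) (λ { (x≢y ∷ _) → x≢y x≡y })
    ... | no x≢y  = mk⇔ ((x≢y ∷_) ∘ to) (from ∘ All.tail)
      where open Equivalence (T-not-any⇔All≢ x ys)

  T-noDup⇔Unique : ∀ (xs : List (Fin m)) → T (noDup xs) ⇔ Unique xs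
  T-noDup⇔Unique []       = mk⇔ (λ _ → []) (λ _ → _)
  T-noDup⇔Unique (x ∷ xs) = mk⇔
      (λ t → let (t₁ , t₂) = Equivalence.to T-∧ t in Equivalence.to head t₁ ∷ Equivalence.to tail t₂)
      (λ { (x∉ ∷ u) → Equivalence.from T-∧ (Equivalence.from head x∉ , Equivalence.from tail u) })
    where
    head : T (not (any (λ y → ⌊ x FinP.≟ y ⌋) xs)) ⇔ All (x ≢_) xs
    head = T-not-any⇔All≢ x xs
    tail : T (noDup xs) ⇔ Unique xs
    tail = T-noDup⇔Unique xs

IsPerm-swapAt : ∀ {d} {σ : Vec (Fin d) d} {i j} → i < j → IsPerm σ → IsPerm (swapAt σ i j)
IsPerm-swapAt {σ = σ} i<j σ-perm with toList-swapAt σ i<j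
... | P , B , C , σ≡ , σ′≡ =
  Equivalence.from (T-noDup⇔Unique _) (subst Unique (sym σ′≡)
    (PermₛP.Unique-resp-↭ (setoid _) (↭⇒↭ₛ (↭-transpose P _ B _ C))
      (subst Unique σ≡ (Equivalence.to (T-noDup⇔Unique _) σ-perm))))

noDup-swapAt : ∀ {d} (σ : Vec (Fin d) d) {i j} → i < j → noDup (toList (swapAt σ i j)) ≡ noDup (toList σ)
noDup-swapAt σ {i} {j} i<j = T-injective
  (λ σ′-perm → subst IsPerm (swapAt-involutive (FinP.<⇒≢ i<j) σ) (IsPerm-swapAt {σ = swapAt σ i j} i<j σ′-perm))
  (IsPerm-swapAt {σ = σ} i<j)

sign-swapAt : ∀ {d} (σ : Vec (Fin d) d) {i j} → i < j → IsPerm σ → sign (swapAt σ i j) ≡ - sign σ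
sign-swapAt σ {i} {j} i<j σ-perm with toList-swapAt σ i<j
... | P , B , C , σ≡ , σ′≡ = begin
    listSign (toList (swapAt σ i j))                   ≡⟨ cong listSign σ′≡ ⟩
    listSign (P ++ lookup σ j ∷ B ++ lookup σ i ∷ C)   ≡⟨ listSign-transpose P B C (Unique-++⁻ʳ P σ-unique) ⟩
    - listSign (P ++ lookup σ i ∷ B ++ lookup σ j ∷ C) ≡⟨ cong (-_ ∘ listSign) (sym σ≡) ⟩
    - sign σ                                           ∎
  where
  open ≡-Reasoning
  σ-unique : Unique (P ++ lookup σ i ∷ B ++ lookup σ j ∷ C)
  σ-unique = subst Unique σ≡ (Equivalence.to (T-noDup⇔Unique _) σ-perm)

∑-perms-antisymmetric : ∀ {d} {i j : Fin d} → i < j → (F : Vec (Fin d) d → ℤ) →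
                        (∀ σ → IsPerm σ → F (swapAt σ i j) ≡ - F σ) → ∑ (perms d) F ≡ + 0
∑-perms-antisymmetric {d} {i} {j} i<j F F-odd = begin
    ∑ (perms d) F     ≡⟨ ∑-filter (λ σ → T? (noDup (toList σ))) (allVecs d) F ⟩
    ∑ (allVecs d) F̂   ≡⟨ Multiplicity.∑-sign-reversing-involution (VecP.≡-dec FinP._≟_) (allVecs d) (allVecs-enumeration d)
                           (λ σ → swapAt σ i j) (swapAt-involutive (FinP.<⇒≢ i<j)) F̂ F̂-odd ⟩
    + 0               ∎
  where
  open ≡-Reasoning
  F̂ : Vec (Fin d) d → ℤ
  F̂ σ = if noDup (toList σ) then F σ else + 0
  F̂-odd : ∀ σ → F̂ (swapAt σ i j) ≡ - F̂ σ
  F̂-odd σ rewrite noDup-swapAt σ i<j with noDup (toList σ) in σ-nodup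
  ... | true  = F-odd σ (subst T (sym σ-nodup) _)
  ... | false = refl

toℚ-injective : ∀ {k l} → toℚ k ≡ toℚ l → k ≡ l
toℚ-injective {k} {l} eq = ℤP.+-injective (trans (sym (↥-toℚ k)) (trans (cong ℚ.↥_ eq) (↥-toℚ l)))
  where
  ↥-toℚ : ∀ k → ℚ.↥ (toℚ k) ≡ + k
  ↥-toℚ k = trans (sym (ℤP.*-identityʳ _)) (trans (cong (ℚ.↥ (toℚ k) *_) (sym (ℤGCD.gcd-zeroʳ (+ k)))) (ℚP.↥-/ (+ k) 1))

embed-injective : ∀ {d} {u v : Vec ℕ d} → embed u ≡ embed v → u ≡ v
embed-injective {u = []}    {[]}    _  = refl
embed-injective {u = _ ∷ _} {_ ∷ _} eq = cong₂ _∷_ (toℚ-injective (VecP.∷-injectiveˡ eq)) (embed-injective (VecP.∷-injectiveʳ eq))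

lookup-pt : ∀ {d} (p : Vec ℚ d) σ k → lookup (pt p σ) k ≡ lookup p k ℚ.+ lookup (s d) (lookup σ k)
lookup-pt {d} p σ k = trans (VecP.lookup-zipWith ℚ._+_ k p _) (cong (lookup p k ℚ.+_) (VecP.lookup-map k (lookup (s d)) σ))

swapAt-vertices-agree : ∀ {d} {p : Vec ℚ d} {σ i j} {w w′ : Vec ℕ d} →
                        embed w ≡ pt p σ → embed w′ ≡ pt p (swapAt σ i j) →
                        ∀ k → k ≢ i → k ≢ j → lookup w′ k ≡ lookup w k
swapAt-vertices-agree {d} {p} {σ} {i} {j} {w} {w′} w≡ w′≡ k k≢i k≢j = toℚ-injective (begin
    toℚ (lookup w′ k)                                     ≡⟨ sym (VecP.lookup-map k toℚ w′) ⟩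
    lookup (embed w′) k                                   ≡⟨ cong (λ v → lookup v k) w′≡ ⟩
    lookup (pt p (swapAt σ i j)) k                        ≡⟨ lookup-pt p _ k ⟩
    lookup p k ℚ.+ lookup (s d) (lookup (swapAt σ i j) k) ≡⟨ cong (λ c → lookup p k ℚ.+ lookup (s d) c) (lookup-swapAt-other σ k≢i k≢j) ⟩
    lookup p k ℚ.+ lookup (s d) (lookup σ k)              ≡⟨ sym (lookup-pt p σ k) ⟩
    lookup (pt p σ) k                                     ≡⟨ cong (λ v → lookup v k) (sym w≡) ⟩
    lookup (embed w) k                                    ≡⟨ VecP.lookup-map k toℚ w ⟩
    toℚ (lookup w k)                                      ∎)
  where open ≡-Reasoning

X-cong : ∀ {d} (i j : Fin d) α {w w′ : Vec ℕ d} → (∀ k → k ≢ i → k ≢ j → lookup w′ k ≡ lookup w k) →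
         X i j α w′ ≡ X i j α w
X-cong {d} i j α {w} {w′} agree = cong (λ b → if b then + 1 else + 0) (cong and (ListP.map-cong test-cong (allFin d)))
  where
  test-cong : ∀ k → (⌊ k FinP.≟ i ⌋ ∨ ⌊ k FinP.≟ j ⌋ ∨ ⌊ lookup w′ k ℕP.≟ lookup α k ⌋)
                  ≡ (⌊ k FinP.≟ i ⌋ ∨ ⌊ k FinP.≟ j ⌋ ∨ ⌊ lookup w k ℕP.≟ lookup α k ⌋)
  test-cong k with k FinP.≟ i | k FinP.≟ j
  ... | yes _   | _       = refl
  ... | no _    | yes _   = refl
  ... | no k≢i  | no k≢j  rewrite agree k k≢i k≢j = refl

inner-∑ˡ : ∀ d n {B : Set} (bs : List B) (c : B → ℤ) (u : B → RVec d) (v : RVec d) →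
           inner d n (λ x → ∑ bs (λ b → c b * u b x)) v ≡ ∑ bs (λ b → c b * inner d n (u b) v)
inner-∑ˡ d n bs c u v = begin
    ∑ V (λ x → ∑ bs (λ b → c b * u b x) * v x)   ≡⟨ ∑-cong V (λ x → sym (∑-*ʳ bs _ (v x))) ⟩
    ∑ V (λ x → ∑ bs (λ b → c b * u b x * v x))   ≡⟨ ∑-comm V bs _ ⟩
    ∑ bs (λ b → ∑ V (λ x → c b * u b x * v x))   ≡⟨ ∑-cong bs (λ b → trans (∑-cong V (λ x → ℤP.*-assoc (c b) _ _)) (∑-*ˡ V (c b) _)) ⟩
    ∑ bs (λ b → c b * inner d n (u b) v)         ∎
  where
  open ≡-Reasoning
  V : List (Vec ℕ d)
  V = vertices d n

inner-e-vertex : ∀ {d n w y} → IsVertex d n w → embed w ≡ y → (v : RVec d) → inner d n (e y) v ≡ v w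
inner-e-vertex {d} {n} {w} w-vertex refl v = begin
    ∑ V (λ x → e (embed w) x * v x) ≡⟨ ∑-cong V (λ x → cong (_* v x) (e-embed x)) ⟩
    ∑ V (λ x → δ w x * v x)         ≡⟨ ∑-δ w V v ⟩
    multiplicity w V * v w          ≡⟨ cong (_* v w) (vertices-multiplicity d n w-vertex) ⟩
    + 1 * v w                       ≡⟨ ℤP.*-identityˡ (v w) ⟩
    v w                             ∎
  where
  open ≡-Reasoning
  open Multiplicity (VecP.≡-dec ℕP._≟_)
  V : List (Vec ℕ d)
  V = vertices d n
  e-embed : ∀ x → e (embed w) x ≡ δ w x
  e-embed x with VecP.≡-dec ℚP._≟_ (embed x) (embed w) | VecP.≡-dec ℕP._≟_ x w
  ... | yes _  | yes _    = refl
  ... | no _   | no _     = refl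
  ... | yes eq | no x≢w   = ⊥-elim (x≢w (embed-injective eq))
  ... | no neq | yes refl = ⊥-elim (neq refl)

proposition3p3 : (d n : ℕ) (p : Vec ℚ d)
    → ((σ : Vec (Fin d) d) → IsPerm σ → Σ (Vec ℕ d) (λ x → IsVertex d n x × (embed x ≡ pt p σ)))
    → ((σ τ : Vec (Fin d) d) → IsPerm σ → IsPerm τ → pt p σ ≡ pt p τ → σ ≡ τ)
    → (α : Vec ℕ d) → IsVertex d n α → (i j : Fin d) → i < j
    → inner d n (H p) (X i j α) ≡ + 0
proposition3p3 d n p vertexOf _ α _ i j i<j = begin
    inner d n (H p) (X i j α) ≡⟨ inner-∑ˡ d n (perms d) sign (e ∘ pt p) (X i j α) ⟩
    ∑ (perms d) F             ≡⟨ ∑-perms-antisymmetric i<j F F-odd ⟩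
    + 0                       ∎
  where
  open ≡-Reasoning
  F : Vec (Fin d) d → ℤ
  F σ = sign σ * inner d n (e (pt p σ)) (X i j α)

  F-odd : ∀ σ → IsPerm σ → F (swapAt σ i j) ≡ - F σ
  F-odd σ σ-perm with vertexOf σ σ-perm | vertexOf (swapAt σ i j) (IsPerm-swapAt {σ = σ} i<j σ-perm)
  ... | w , w-vertex , w≡ | w′ , w′-vertex , w′≡ = begin
    F (swapAt σ i j)
      ≡⟨ cong₂ _*_ (sign-swapAt σ i<j σ-perm) (inner-e-vertex w′-vertex w′≡ (X i j α)) ⟩
    - sign σ * X i j α w′
      ≡⟨ cong (- sign σ *_) (X-cong i j α {w} {w′} (swapAt-vertices-agree w≡ w′≡)) ⟩
    - sign σ * X i j α w
      ≡⟨ cong (- sign σ *_) (sym (inner-e-vertex w-vertex w≡ (X i j α))) ⟩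
    - sign σ * inner d n (e (pt p σ)) (X i j α)
      ≡⟨ sym (ℤP.neg-distribˡ-* (sign σ) _) ⟩
    - F σ ∎
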